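{- For each residue class $c \in \{0,2,3\}$, there are infinitely many positive integers $n \equiv c \pmod 4$ such that $S_n^2(X_1,\dots,X_n)$ can be computed over $\mathrm{GF}(2)$ by a homogeneous $\Sigma\Pi\Sigma$ circuit with $\lceil \frac{n}{2}\rceil$ multiplication gates. Moreover, there are infinitely many positive integers $n \equiv 1 \pmod 4$ such that $S_n^2(X_1,\dots,X_n)$ can be computed over $\mathrm{GF}(2)$ by a homogeneous $\Sigma\Pi\Sigma$ circuit with $\lfloor \frac{n}{2}\rfloor$ multiplication gates.
   Context: $S_n^2(X_1,\dots,X_n) = \sum_{1\le i<j\le n} X_iX_j$. A $\Sigma\Pi\Sigma$ circuit over a field $\mathbb{F}$ in variables $X_1,\dots,X_n$ is an expression $\sum_{i=1}^r \prod_{j=1}^{s_i} L_{ij}(X)$ where each $L_{ij}$ is a linear form $a_0+\sum_{k=1}^n a_kX_k$ with $a_0,\dots,a_n\in\mathbb{F}$; $r$ is its number of multiplication gates. It is homogeneous if every $L_{ij}$ has constant term $a_0=0$. It computes a polynomial $P$ if the expression equals $P$ in $\mathbb{F}[X_1,\dots,X_n]$. -}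

module Defs where

open import Data.Bool using (Bool; true; false; not; if_then_else_)
open import Data.Nat using (ℕ; zero; suc; _+_; _<ᵇ_)
open import Data.Nat.Properties using () renaming (_≟_ to _≟ℕ_)
open import Data.Fin using (Fin; toℕ; _≟_)
open import Data.List using (List; []; _∷_; _++_; map; concatMap; foldr; filter; length)
open import Data.List.Relation.Unary.All using (All)
open import Data.Vec using (Vec; replicate; zipWith; tabulate; toList; allFin; lookup)
open import Data.Vec.Properties using (≡-dec)
open import Relation.Nullary.Decidable using (⌊_⌋)
open import Relation.Binary.PropositionalEquality using (_≡_)

-- The field GF(2) is represented by Bool (false = 0, true = 1, addition = xor).

Mono : ℕ → Set
Mono n = Vec ℕ n

-- A polynomial over GF(2) is presented as a formal sum (list) of monomials,
-- each with coefficient 1; its coefficient at a monomial m is the number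
-- of occurrences of m, taken mod 2.
Poly : ℕ → Set
Poly n = List (Mono n)

coeff : ∀ {n} → Mono n → Poly n → Bool
coeff m []       = false
coeff m (x ∷ p)  = if ⌊ ≡-dec _≟ℕ_ m x ⌋ then not (coeff m p) else coeff m p

_≈P_ : ∀ {n} → Poly n → Poly n → Set
p ≈P q = ∀ m → coeff m p ≡ coeff m q

unitMono : ∀ {n} → Mono n
unitMono {n} = replicate n 0

var : ∀ {n} → Fin n → Mono n
var k = tabulate (λ i → if ⌊ i ≟ k ⌋ then 1 else 0)

_*P_ : ∀ {n} → Poly n → Poly n → Poly n
p *P q = concatMap (λ a → map (λ b → zipWith _+_ a b) q) p

prodP : ∀ {n} → List (Poly n) → Poly n
prodP = foldr _*P_ (unitMono ∷ [])

record LinForm (n : ℕ) : Set where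
  constructor linForm
  field
    const : Bool
    coeffs : Vec Bool n

open LinForm public

linPoly : ∀ {n} → LinForm n → Poly n
linPoly {n} L =
  (if const L then unitMono ∷ [] else [])
  ++ concatMap (λ k → if lookup (coeffs L) k then var k ∷ [] else []) (toList (allFin n))

-- A ΣΠΣ circuit: a list of multiplication gates, each a list of linear forms.
Circuit : ℕ → Set
Circuit n = List (List (LinForm n))

gates : ∀ {n} → Circuit n → ℕ
gates = length

Homogeneous : ∀ {n} → Circuit n → Set
Homogeneous C = All (All (λ L → const L ≡ false)) C

circuitPoly : ∀ {n} → Circuit n → Poly n
circuitPoly C = concatMap (λ g → prodP (map linPoly g)) C

Computes : ∀ {n} → Circuit n → Poly n → Set
Computes C P = circuitPoly C ≈P P

S2 : (n : ℕ) → Poly n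
S2 n = concatMap (λ i → concatMap (λ j →
         if toℕ i <ᵇ toℕ j then zipWith _+_ (var i) (var j) ∷ [] else [])
         (toList (allFin n))) (toList (allFin n))

-- Over GF(2) a gate (a·X)(b·X) computes Σ_{k,l} a_k b_l X_k X_l, so a circuit of
-- such gates computes the quadratic polynomial of the bilinear form F = Σ a ⊗ b.
-- That polynomial is S_n^2 exactly when F has zero diagonal and F + Fᵀ is 1 off
-- the diagonal, and adding an alternating form to F does not change it.
-- Four gates realise S_9^2. Substituting X_9 := X_9 + ... + X_{8+n} in them and
-- adding a circuit for S_n^2 in X_9, ..., X_{8+n} gives a circuit for S_{8+n}^2,
-- since S_{8+n}^2 = S_8^2 + (X_1 + ... + X_8)(X_9 + ... + X_{8+n}) + S_n^2.
-- Iterating this from S_0^2, S_1^2 (no gates), S_2^2 (one gate) and S_3^2 (two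
-- gates) adds 8 variables and 4 gates at each step.
module Submission where

open import Defs
open import Algebra.Bundles using (CommutativeRing)
open import Data.Bool using (Bool; true; false; not; _∧_; _xor_; if_then_else_)
open import Data.Bool.Properties
  using (xor-∧-commutativeRing; xor-assoc; xor-same; xor-identityʳ; xor-annihilates-not;
         not-distribˡ-xor; ∧-assoc; ∧-zeroʳ; ∧-distribʳ-xor; if-float)
  renaming (_≟_ to _≟ᵇ_)
open import Data.Empty using (⊥-elim)
open import Data.Fin using (Fin; zero; suc; toℕ; inject₁; fromℕ; splitAt; join) renaming (_≟_ to _≟ᶠ_)
open import Data.Fin.Properties using (toℕ-injective; inject₁-injective; fromℕ≢inject₁; join-splitAt; all?)
open import Data.List using (List; []; _∷_; _++_; map; concatMap; length)
open import Data.List.Properties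
  using (++-identityʳ; concatMap-cong; concatMap-++; map-concatMap; length-map; length-++)
open import Data.List.Relation.Unary.All using ([]; _∷_)
open import Data.Maybe using (Maybe; just; nothing; maybe′)
open import Data.Nat using (ℕ; zero; suc; _+_; _*_; _<_; _%_; _<ᵇ_; _≡ᵇ_; ⌈_/2⌉; ⌊_/2⌋)
open import Data.Nat.DivMod using ([m+kn]%n≡m%n)
open import Data.Nat.Properties
  using (+-comm; +-identityʳ; *-assoc; n<1+n; m≤m*n; m≤m+n; ≤-trans; <-≤-trans)
  renaming (_≟_ to _≟ℕ_)
open import Data.Product using (_×_; _,_; ∃-syntax)
open import Data.Sum using (_⊎_; inj₁; inj₂; [_,_]′)
open import Data.Vec using (Vec; []; _∷_; lookup; tabulate; toList; allFin; zipWith)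
open import Data.Vec.Properties using (≡-dec; zipWith-identityʳ; zipWith-comm; lookup∘tabulate)
open import Function using (_∘_; id)
open import Function.Definitions using (Injective)
open import Relation.Binary.PropositionalEquality
  using (_≡_; _≢_; refl; sym; trans; cong; cong₂; module ≡-Reasoning)
open import Relation.Nullary.Decidable
  using (Dec; yes; no; ⌊_⌋; map′; ¬?; _×-dec_; _→-dec_; from-yes)

open import Algebra.Properties.Semiring.Sum (CommutativeRing.semiring xor-∧-commutativeRing)
  using (sum-syntax; sum-cong-≗; ∑-distrib-+; *-distribˡ-sum)

open ≡-Reasoning

xor≡true⇒≡not : ∀ {x y} → x xor y ≡ true → x ≡ not y
xor≡true⇒≡not {false} {true}  _ = refl
xor≡true⇒≡not {true}  {false} _ = refl

xor≡false⇒≡ : ∀ {x y} → x xor y ≡ false → x ≡ y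
xor≡false⇒≡ {false}         eq = sym eq
xor≡false⇒≡ {true}  {true}  _  = refl

<ᵇ-irrefl : ∀ x → (x <ᵇ x) ≡ false
<ᵇ-irrefl zero    = refl
<ᵇ-irrefl (suc x) = <ᵇ-irrefl x

≢⇒<ᵇ-xor-<ᵇ : ∀ {x y} → x ≢ y → (x <ᵇ y) xor (y <ᵇ x) ≡ true
≢⇒<ᵇ-xor-<ᵇ {zero}  {zero}  x≢y = ⊥-elim (x≢y refl)
≢⇒<ᵇ-xor-<ᵇ {zero}  {suc y} _   = refl
≢⇒<ᵇ-xor-<ᵇ {suc x} {zero}  _   = refl
≢⇒<ᵇ-xor-<ᵇ {suc x} {suc y} x≢y = ≢⇒<ᵇ-xor-<ᵇ (x≢y ∘ cong suc)

Form : Set → Set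
Form A = A → A → Bool

record Alternating {A : Set} (H : Form A) : Set where
  constructor alternating
  field
    symmetric : ∀ k l → H k l ≡ H l k
    diagonal  : ∀ k → H k k ≡ false

-- The first row and the first column cancel by symmetry.
∑∑-alternating : ∀ {n} {H : Form (Fin n)} → Alternating H → ∑[ k < n ] ∑[ l < n ] H k l ≡ false
∑∑-alternating {zero}      _                       = refl
∑∑-alternating {suc n} {H} (alternating symm diag) = begin
  (H zero zero xor row) xor ∑[ k < n ] (H (suc k) zero xor ∑[ l < n ] H (suc k) (suc l))
    ≡⟨ cong₂ (λ d s → (d xor row) xor s) (diag zero) (∑-distrib-+ (λ k → H (suc k) zero) _) ⟩
  row xor (∑[ k < n ] H (suc k) zero xor ∑[ k < n ] ∑[ l < n ] H (suc k) (suc l))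
    ≡⟨ cong₂ (λ c s → row xor (c xor s))
             (sum-cong-≗ (λ k → symm (suc k) zero))
             (∑∑-alternating (alternating (λ k l → symm (suc k) (suc l)) (λ k → diag (suc k)))) ⟩
  row xor (row xor false)
    ≡⟨ cong (row xor_) (xor-identityʳ row) ⟩
  row xor row
    ≡⟨ xor-same row ⟩
  false ∎
  where
  row : Bool
  row = ∑[ l < n ] H zero (suc l)

record IsS2Form {A : Set} (F : Form A) : Set where
  constructor isS2Form
  field
    diagonal    : ∀ k → F k k ≡ false
    offDiagonal : ∀ k l → k ≢ l → F k l xor F l k ≡ true

isS2Form? : ∀ {n} (F : Form (Fin n)) → Dec (IsS2Form F)
isS2Form? F = map′ (λ (d , o) → isS2Form d o) (λ (isS2Form d o) → d , o)
  (all? (λ k → F k k ≟ᵇ false) ×-dec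
   all? (λ k → all? (λ l → ¬? (k ≟ᶠ l) →-dec (F k l xor F l k ≟ᵇ true))))

IsS2Form-alternating : ∀ {n} {F G : Form (Fin n)} → IsS2Form F → IsS2Form G →
                       Alternating (λ k l → F k l xor G k l)
IsS2Form-alternating {F = F} {G} (isS2Form F-diag F-off) (isS2Form G-diag G-off) =
  alternating symmetric diagonal
  where
  symmetric : ∀ k l → F k l xor G k l ≡ F l k xor G l k
  symmetric k l with k ≟ᶠ l
  ... | yes refl = refl
  ... | no k≢l   = trans (cong₂ _xor_ (xor≡true⇒≡not {F k l} (F-off k l k≢l))
                                           (xor≡true⇒≡not {G k l} (G-off k l k≢l)))
                         (xor-annihilates-not (F l k) (G l k))
  diagonal : ∀ k → F k k xor G k k ≡ false
  diagonal k = cong₂ _xor_ (F-diag k) (G-diag k)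

IsS2Form-pullback : ∀ {A B} {F : Form B} {G : Form A} (σ : A → B) → Injective _≡_ _≡_ σ →
                    (∀ k l → G k l ≡ F (σ k) (σ l)) → IsS2Form F → IsS2Form G
IsS2Form-pullback σ σ-injective G≗F∘σ (isS2Form diag off) = isS2Form
  (λ k → trans (G≗F∘σ k k) (diag (σ k)))
  (λ k l k≢l → trans (cong₂ _xor_ (G≗F∘σ k l) (G≗F∘σ l k))
                      (off (σ k) (σ l) (k≢l ∘ σ-injective)))

strictlyUpper : ∀ {n} → Form (Fin n)
strictlyUpper k l = toℕ k <ᵇ toℕ l

strictlyUpper-isS2Form : ∀ {n} → IsS2Form (strictlyUpper {n})
strictlyUpper-isS2Form =
  isS2Form (λ k → <ᵇ-irrefl (toℕ k)) (λ k l k≢l → ≢⇒<ᵇ-xor-<ᵇ (k≢l ∘ toℕ-injective))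

_·ₘ_ : ∀ {n} → Mono n → Mono n → Mono n
_·ₘ_ = zipWith _+_

isVarProduct : ∀ {n} → Mono n → Fin n → Fin n → Bool
isVarProduct m k l = coeff m (var k ·ₘ var l ∷ [])

isVarProduct-comm : ∀ {n} (m : Mono n) k l → isVarProduct m k l ≡ isVarProduct m l k
isVarProduct-comm m k l = cong (λ x → coeff m (x ∷ [])) (zipWith-comm +-comm (var k) (var l))

coeff-++ : ∀ {n} (m : Mono n) (p q : Poly n) → coeff m (p ++ q) ≡ coeff m p xor coeff m q
coeff-++ m []      q = refl
coeff-++ m (x ∷ p) q with ⌊ ≡-dec _≟ℕ_ m x ⌋
... | true  = trans (cong not (coeff-++ m p q)) (not-distribˡ-xor (coeff m p) (coeff m q))
... | false = coeff-++ m p q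

coeff-if : ∀ {n} (m : Mono n) c (p : Poly n) → coeff m (if c then p else []) ≡ c ∧ coeff m p
coeff-if m true  p = refl
coeff-if m false p = refl

coeff-concatMap-tabulate : ∀ {n k} {A : Set} (m : Mono n) (F : A → Poly n) (g : Fin k → A) →
  coeff m (concatMap F (toList (tabulate g))) ≡ ∑[ i < k ] coeff m (F (g i))
coeff-concatMap-tabulate {k = zero}  m F g = refl
coeff-concatMap-tabulate {k = suc k} m F g =
  trans (coeff-++ m (F (g zero)) _)
        (cong (coeff m (F (g zero)) xor_) (coeff-concatMap-tabulate m F (g ∘ suc)))

concatMap-*P : ∀ {n} {A : Set} (F : A → Poly n) (xs : List A) (q : Poly n) →
               concatMap F xs *P q ≡ concatMap (λ x → F x *P q) xs
concatMap-*P F []       q = refl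
concatMap-*P F (x ∷ xs) q =
  trans (concatMap-++ _ (F x) (concatMap F xs)) (cong (F x *P q ++_) (concatMap-*P F xs q))

*P-identityʳ : ∀ {n} (p : Poly n) → p *P (unitMono ∷ []) ≡ p
*P-identityʳ []      = refl
*P-identityʳ (x ∷ p) = cong₂ _∷_ (zipWith-identityʳ +-identityʳ x) (*P-identityʳ p)

linear : ∀ {n} → (Fin n → Bool) → LinForm n
linear a = linForm false (tabulate a)

linPoly-linear : ∀ {n} (a : Fin n → Bool) →
  linPoly (linear a) ≡ concatMap (λ k → if a k then var k ∷ [] else []) (toList (allFin n))
linPoly-linear {n} a =
  concatMap-cong (λ k → cong (λ c → if c then var k ∷ [] else []) (lookup∘tabulate a k))
                 (toList (allFin n))

coeff-linear-*P : ∀ {n} (m : Mono n) (a : Fin n → Bool) (q : Poly n) →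
  coeff m (linPoly (linear a) *P q) ≡ ∑[ k < n ] (a k ∧ coeff m (map (var k ·ₘ_) q))
coeff-linear-*P {n} m a q = begin
  coeff m (linPoly (linear a) *P q)
    ≡⟨ cong (λ p → coeff m (p *P q)) (linPoly-linear a) ⟩
  coeff m (concatMap monomialIf (toList (allFin n)) *P q)
    ≡⟨ cong (coeff m) (concatMap-*P monomialIf (toList (allFin n)) q) ⟩
  coeff m (concatMap (λ k → monomialIf k *P q) (toList (allFin n)))
    ≡⟨ coeff-concatMap-tabulate m (λ k → monomialIf k *P q) id ⟩
  ∑[ k < n ] coeff m (monomialIf k *P q)
    ≡⟨ sum-cong-≗ (λ k → trans (cong (coeff m) (if-float (_*P q) (a k))) (coeff-if m (a k) _)) ⟩
  ∑[ k < n ] (a k ∧ coeff m (map (var k ·ₘ_) q ++ []))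
    ≡⟨ sum-cong-≗ (λ k → cong (λ p → a k ∧ coeff m p) (++-identityʳ (map (var k ·ₘ_) q))) ⟩
  ∑[ k < n ] (a k ∧ coeff m (map (var k ·ₘ_) q)) ∎
  where
  monomialIf : Fin n → Poly n
  monomialIf k = if a k then var k ∷ [] else []

coeff-map-linear : ∀ {n} (m : Mono n) (f : Mono n → Mono n) (a : Fin n → Bool) →
  coeff m (map f (linPoly (linear a))) ≡ ∑[ l < n ] (a l ∧ coeff m (f (var l) ∷ []))
coeff-map-linear {n} m f a = begin
  coeff m (map f (linPoly (linear a)))
    ≡⟨ cong (coeff m ∘ map f) (linPoly-linear a) ⟩
  coeff m (map f (concatMap monomialIf (toList (allFin n))))
    ≡⟨ cong (coeff m) (map-concatMap f monomialIf (toList (allFin n))) ⟩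
  coeff m (concatMap (map f ∘ monomialIf) (toList (allFin n)))
    ≡⟨ coeff-concatMap-tabulate m (map f ∘ monomialIf) id ⟩
  ∑[ l < n ] coeff m (map f (monomialIf l))
    ≡⟨ sum-cong-≗ (λ l → trans (cong (coeff m) (if-float (map f) (a l))) (coeff-if m (a l) _)) ⟩
  ∑[ l < n ] (a l ∧ coeff m (f (var l) ∷ [])) ∎
  where
  monomialIf : Fin n → Poly n
  monomialIf l = if a l then var l ∷ [] else []

quadratic : ∀ {n} → Form (Fin n) → Poly n
quadratic {n} F =
  concatMap (λ k → concatMap (λ l → if F k l then var k ·ₘ var l ∷ [] else [])
                             (toList (allFin n)))
            (toList (allFin n))

quadraticCoeff : ∀ {n} → Form (Fin n) → Mono n → Bool
quadraticCoeff {n} F m = ∑[ k < n ] ∑[ l < n ] (F k l ∧ isVarProduct m k l)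

coeff-quadratic : ∀ {n} (F : Form (Fin n)) (m : Mono n) → coeff m (quadratic F) ≡ quadraticCoeff F m
coeff-quadratic {n} F m =
  trans (coeff-concatMap-tabulate m row id)
        (sum-cong-≗ (λ k → trans (coeff-concatMap-tabulate m (term k) id)
                                 (sum-cong-≗ (λ l → coeff-if m (F k l) _))))
  where
  term : Fin n → Fin n → Poly n
  term k l = if F k l then var k ·ₘ var l ∷ [] else []
  row : Fin n → Poly n
  row k = concatMap (term k) (toList (allFin n))

quadraticCoeff-xor : ∀ {n} (F G : Form (Fin n)) (m : Mono n) →
  quadraticCoeff F m xor quadraticCoeff G m ≡ quadraticCoeff (λ k l → F k l xor G k l) m
quadraticCoeff-xor {n} F G m = begin
  quadraticCoeff F m xor quadraticCoeff G m
    ≡⟨ sym (∑-distrib-+ (λ k → ∑[ l < n ] (F k l ∧ E k l)) (λ k → ∑[ l < n ] (G k l ∧ E k l))) ⟩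
  ∑[ k < n ] (∑[ l < n ] (F k l ∧ E k l) xor ∑[ l < n ] (G k l ∧ E k l))
    ≡⟨ sum-cong-≗ (λ k → sym (∑-distrib-+ (λ l → F k l ∧ E k l) (λ l → G k l ∧ E k l))) ⟩
  ∑[ k < n ] ∑[ l < n ] ((F k l ∧ E k l) xor (G k l ∧ E k l))
    ≡⟨ sum-cong-≗ (λ k → sum-cong-≗ (λ l → sym (∧-distribʳ-xor (E k l) (F k l) (G k l)))) ⟩
  quadraticCoeff (λ k l → F k l xor G k l) m ∎
  where
  E : Fin n → Fin n → Bool
  E = isVarProduct m

quadratic-cong : ∀ {n} {F G : Form (Fin n)} → Alternating (λ k l → F k l xor G k l) →
                 quadratic F ≈P quadratic G
quadratic-cong {F = F} {G} (alternating symm diag) m = begin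
  coeff m (quadratic F)
    ≡⟨ coeff-quadratic F m ⟩
  quadraticCoeff F m
    ≡⟨ xor≡false⇒≡ (trans (quadraticCoeff-xor F G m) (∑∑-alternating alternating-termwise)) ⟩
  quadraticCoeff G m
    ≡⟨ sym (coeff-quadratic G m) ⟩
  coeff m (quadratic G) ∎
  where
  alternating-termwise : Alternating (λ k l → (F k l xor G k l) ∧ isVarProduct m k l)
  alternating-termwise = alternating
    (λ k l → cong₂ _∧_ (symm k l) (isVarProduct-comm m k l))
    (λ k → cong (_∧ isVarProduct m k k) (diag k))

RankOne : ℕ → Set
RankOne n = (Fin n → Bool) × (Fin n → Bool)

gate : ∀ {n} → RankOne n → List (LinForm n)
gate (a , b) = linear a ∷ linear b ∷ []

circuit : ∀ {n} → List (RankOne n) → Circuit n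
circuit = map gate

bilinearForm : ∀ {n} → List (RankOne n) → Form (Fin n)
bilinearForm []             k l = false
bilinearForm ((a , b) ∷ ps) k l = (a k ∧ b l) xor bilinearForm ps k l

circuit-homogeneous : ∀ {n} (ps : List (RankOne n)) → Homogeneous (circuit ps)
circuit-homogeneous []       = []
circuit-homogeneous (_ ∷ ps) = (refl ∷ refl ∷ []) ∷ circuit-homogeneous ps

gates-circuit : ∀ {n} (ps : List (RankOne n)) → gates (circuit ps) ≡ length ps
gates-circuit = length-map gate

coeff-gate : ∀ {n} (m : Mono n) (a b : Fin n → Bool) →
  coeff m (prodP (map linPoly (gate (a , b)))) ≡ quadraticCoeff (λ k l → a k ∧ b l) m
coeff-gate {n} m a b = begin
  coeff m (linPoly (linear a) *P (linPoly (linear b) *P (unitMono ∷ [])))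
    ≡⟨ cong (λ q → coeff m (linPoly (linear a) *P q)) (*P-identityʳ (linPoly (linear b))) ⟩
  coeff m (linPoly (linear a) *P linPoly (linear b))
    ≡⟨ coeff-linear-*P m a (linPoly (linear b)) ⟩
  ∑[ k < n ] (a k ∧ coeff m (map (var k ·ₘ_) (linPoly (linear b))))
    ≡⟨ sum-cong-≗ (λ k → cong (a k ∧_) (coeff-map-linear m (var k ·ₘ_) b)) ⟩
  ∑[ k < n ] (a k ∧ ∑[ l < n ] (b l ∧ E k l))
    ≡⟨ sum-cong-≗ (λ k → *-distribˡ-sum (a k) (λ l → b l ∧ E k l)) ⟩
  ∑[ k < n ] ∑[ l < n ] (a k ∧ (b l ∧ E k l))
    ≡⟨ sum-cong-≗ (λ k → sum-cong-≗ (λ l → sym (∧-assoc (a k) (b l) (E k l)))) ⟩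
  quadraticCoeff (λ k l → a k ∧ b l) m ∎
  where
  E : Fin n → Fin n → Bool
  E = isVarProduct m

coeff-circuit : ∀ {n} (m : Mono n) (ps : List (RankOne n)) →
  coeff m (circuitPoly (circuit ps)) ≡ quadraticCoeff (bilinearForm ps) m
coeff-circuit {n} m []             =
  sym (∑∑-alternating {n} {H = λ _ _ → false} (alternating (λ _ _ → refl) (λ _ → refl)))
coeff-circuit     m ((a , b) ∷ ps) = begin
  coeff m (prodP (map linPoly (gate (a , b))) ++ circuitPoly (circuit ps))
    ≡⟨ coeff-++ m (prodP (map linPoly (gate (a , b)))) (circuitPoly (circuit ps)) ⟩
  coeff m (prodP (map linPoly (gate (a , b)))) xor coeff m (circuitPoly (circuit ps))
    ≡⟨ cong₂ _xor_ (coeff-gate m a b) (coeff-circuit m ps) ⟩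
  quadraticCoeff (λ k l → a k ∧ b l) m xor quadraticCoeff (bilinearForm ps) m
    ≡⟨ quadraticCoeff-xor (λ k l → a k ∧ b l) (bilinearForm ps) m ⟩
  quadraticCoeff (bilinearForm ((a , b) ∷ ps)) m ∎

circuit-computes-S2 : ∀ {n} (ps : List (RankOne n)) → IsS2Form (bilinearForm ps) →
                      Computes (circuit ps) (S2 n)
circuit-computes-S2 ps isS2 m = begin
  coeff m (circuitPoly (circuit ps))
    ≡⟨ coeff-circuit m ps ⟩
  quadraticCoeff (bilinearForm ps) m
    ≡⟨ sym (coeff-quadratic (bilinearForm ps) m) ⟩
  coeff m (quadratic (bilinearForm ps))
    ≡⟨ quadratic-cong (IsS2Form-alternating {F = bilinearForm ps} isS2 strictlyUpper-isS2Form) m ⟩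
  coeff m (quadratic strictlyUpper) ∎

bilinearForm-++ : ∀ {n} (ps qs : List (RankOne n)) k l →
                  bilinearForm (ps ++ qs) k l ≡ bilinearForm ps k l xor bilinearForm qs k l
bilinearForm-++ []             qs k l = refl
bilinearForm-++ ((a , b) ∷ ps) qs k l =
  trans (cong ((a k ∧ b l) xor_) (bilinearForm-++ ps qs k l))
        (sym (xor-assoc (a k ∧ b l) (bilinearForm ps k l) (bilinearForm qs k l)))

-- σ k = just i stands for the substitution X_i := Σ_{σ k = just i} Y_k.
substitute : ∀ {n n′} → (Fin n′ → Maybe (Fin n)) → RankOne n → RankOne n′
substitute σ (a , b) = maybe′ a false ∘ σ , maybe′ b false ∘ σ

liftForm : ∀ {n} → Form (Fin n) → Form (Maybe (Fin n))
liftForm F x y = maybe′ (λ k → maybe′ (F k) false y) false x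

bilinearForm-substitute : ∀ {n n′} (σ : Fin n′ → Maybe (Fin n)) (ps : List (RankOne n)) k l →
  bilinearForm (map (substitute σ) ps) k l ≡ liftForm (bilinearForm ps) (σ k) (σ l)
bilinearForm-substitute σ []             k l = sym (liftForm-zero (σ k) (σ l))
  where
  liftForm-zero : ∀ {n} (x y : Maybe (Fin n)) → liftForm (λ _ _ → false) x y ≡ false
  liftForm-zero (just k) (just l) = refl
  liftForm-zero (just k) nothing  = refl
  liftForm-zero nothing  y        = refl
bilinearForm-substitute σ ((a , b) ∷ ps) k l =
  trans (cong ((maybe′ a false (σ k) ∧ maybe′ b false (σ l)) xor_)
              (bilinearForm-substitute σ ps k l))
        (liftForm-rankOne (σ k) (σ l))
  where
  liftForm-rankOne : ∀ x y → (maybe′ a false x ∧ maybe′ b false y) xor liftForm (bilinearForm ps) x y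
                             ≡ liftForm (bilinearForm ((a , b) ∷ ps)) x y
  liftForm-rankOne (just k) (just l) = refl
  liftForm-rankOne (just k) nothing  = cong (_xor false) (∧-zeroʳ (a k))
  liftForm-rankOne nothing  y        = refl

collapse : ∀ m {n} → Fin (m + n) → Fin (suc m)
collapse m k = [ inject₁ , (λ _ → fromℕ m) ]′ (splitAt m k)

restrict : ∀ m {n} → Fin (m + n) → Maybe (Fin n)
restrict m k = [ (λ _ → nothing) , just ]′ (splitAt m k)

-- The last variable of bs becomes the sum of the variables of ps.
glue : ∀ {m n} → List (RankOne (suc m)) → List (RankOne n) → List (RankOne (m + n))
glue {m} bs ps = map (substitute (just ∘ collapse m)) bs ++ map (substitute (restrict m)) ps

glued : ∀ {m n} → Form (Fin (suc m)) → Form (Fin n) → Form (Fin m ⊎ Fin n)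
glued {m} B F (inj₁ i) (inj₁ j) = B (inject₁ i) (inject₁ j)
glued {m} B F (inj₁ i) (inj₂ _) = B (inject₁ i) (fromℕ m)
glued {m} B F (inj₂ _) (inj₁ j) = B (fromℕ m) (inject₁ j)
glued {m} B F (inj₂ i) (inj₂ j) = B (fromℕ m) (fromℕ m) xor F i j

bilinearForm-glue : ∀ {m n} (bs : List (RankOne (suc m))) (ps : List (RankOne n)) k l →
  bilinearForm (glue bs ps) k l ≡ glued (bilinearForm bs) (bilinearForm ps) (splitAt m k) (splitAt m l)
bilinearForm-glue {m} {n} bs ps k l =
  trans (bilinearForm-++ (map (substitute (just ∘ collapse m)) bs) (map (substitute (restrict m)) ps) k l)
        (trans (cong₂ _xor_ (bilinearForm-substitute (just ∘ collapse m) bs k l)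
                            (bilinearForm-substitute (restrict m) ps k l))
               split)
  where
  B : Form (Fin (suc m))
  B = bilinearForm bs
  F : Form (Fin n)
  F = bilinearForm ps
  split : B (collapse m k) (collapse m l) xor liftForm F (restrict m k) (restrict m l)
          ≡ glued B F (splitAt m k) (splitAt m l)
  split with splitAt m k | splitAt m l
  ... | inj₁ i | inj₁ j = xor-identityʳ _
  ... | inj₁ i | inj₂ j = xor-identityʳ _
  ... | inj₂ i | inj₁ j = xor-identityʳ _
  ... | inj₂ i | inj₂ j = refl

glued-isS2Form : ∀ {m n} {B : Form (Fin (suc m))} {F : Form (Fin n)} →
                 IsS2Form B → IsS2Form F → IsS2Form (glued B F)
glued-isS2Form {m} {B = B} {F} (isS2Form B-diag B-off) (isS2Form F-diag F-off) = isS2Form diag off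
  where
  diag : ∀ x → glued B F x x ≡ false
  diag (inj₁ i) = B-diag (inject₁ i)
  diag (inj₂ i) = trans (cong (_xor F i i) (B-diag (fromℕ m))) (F-diag i)
  off : ∀ x y → x ≢ y → glued B F x y xor glued B F y x ≡ true
  off (inj₁ i) (inj₁ j) i≢j = B-off _ _ (i≢j ∘ cong inj₁ ∘ inject₁-injective)
  off (inj₁ i) (inj₂ j) _   = B-off _ _ (fromℕ≢inject₁ ∘ sym)
  off (inj₂ i) (inj₁ j) _   = B-off _ _ fromℕ≢inject₁
  off (inj₂ i) (inj₂ j) i≢j =
    trans (cong (λ d → (d xor F i j) xor (d xor F j i)) (B-diag (fromℕ m)))
          (F-off i j (i≢j ∘ cong inj₂))

splitAt-injective : ∀ m {n} → Injective _≡_ _≡_ (splitAt m {n})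
splitAt-injective m {n} {k} {l} eq =
  trans (sym (join-splitAt m n k)) (trans (cong (join m n) eq) (join-splitAt m n l))

glue-isS2Form : ∀ {m n} (bs : List (RankOne (suc m))) (ps : List (RankOne n)) →
  IsS2Form (bilinearForm bs) → IsS2Form (bilinearForm ps) → IsS2Form (bilinearForm (glue bs ps))
glue-isS2Form {m} bs ps bs-S2 ps-S2 =
  IsS2Form-pullback (splitAt m) (splitAt-injective m) (bilinearForm-glue bs ps) (glued-isS2Form bs-S2 ps-S2)

length-glue : ∀ {m n} (bs : List (RankOne (suc m))) (ps : List (RankOne n)) →
              length (glue bs ps) ≡ length bs + length ps
length-glue {m} bs ps =
  trans (length-++ (map (substitute (just ∘ collapse m)) bs))
        (cong₂ _+_ (length-map _ bs) (length-map _ ps))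

bits : ∀ {n} → Vec ℕ n → Fin n → Bool
bits v k = lookup v k ≡ᵇ 1

gatesS0 : List (RankOne 0)
gatesS0 = []

gatesS1 : List (RankOne 1)
gatesS1 = []

gatesS2 : List (RankOne 2)
gatesS2 = (bits (1 ∷ 0 ∷ []) , bits (0 ∷ 1 ∷ [])) ∷ []

gatesS3 : List (RankOne 3)
gatesS3 = (bits (1 ∷ 0 ∷ 0 ∷ []) , bits (0 ∷ 1 ∷ 1 ∷ []))
        ∷ (bits (0 ∷ 1 ∷ 0 ∷ []) , bits (0 ∷ 0 ∷ 1 ∷ []))
        ∷ []

gatesS9 : List (RankOne 9)
gatesS9 = (bits (1 ∷ 0 ∷ 0 ∷ 0 ∷ 0 ∷ 1 ∷ 1 ∷ 1 ∷ 0 ∷ [])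
          , bits (0 ∷ 0 ∷ 0 ∷ 0 ∷ 0 ∷ 1 ∷ 1 ∷ 1 ∷ 1 ∷ []))
        ∷ (bits (0 ∷ 1 ∷ 0 ∷ 0 ∷ 1 ∷ 0 ∷ 1 ∷ 1 ∷ 0 ∷ [])
          , bits (1 ∷ 0 ∷ 0 ∷ 0 ∷ 1 ∷ 1 ∷ 0 ∷ 0 ∷ 1 ∷ []))
        ∷ (bits (0 ∷ 0 ∷ 1 ∷ 0 ∷ 1 ∷ 1 ∷ 1 ∷ 0 ∷ 0 ∷ [])
          , bits (1 ∷ 1 ∷ 0 ∷ 0 ∷ 0 ∷ 0 ∷ 1 ∷ 0 ∷ 1 ∷ []))
        ∷ (bits (0 ∷ 0 ∷ 0 ∷ 1 ∷ 1 ∷ 1 ∷ 0 ∷ 1 ∷ 0 ∷ [])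
          , bits (1 ∷ 1 ∷ 1 ∷ 0 ∷ 1 ∷ 1 ∷ 1 ∷ 1 ∷ 1 ∷ []))
        ∷ []

gatesS0-isS2Form : IsS2Form (bilinearForm gatesS0)
gatesS0-isS2Form = from-yes (isS2Form? (bilinearForm gatesS0))

gatesS1-isS2Form : IsS2Form (bilinearForm gatesS1)
gatesS1-isS2Form = from-yes (isS2Form? (bilinearForm gatesS1))

gatesS2-isS2Form : IsS2Form (bilinearForm gatesS2)
gatesS2-isS2Form = from-yes (isS2Form? (bilinearForm gatesS2))

gatesS3-isS2Form : IsS2Form (bilinearForm gatesS3)
gatesS3-isS2Form = from-yes (isS2Form? (bilinearForm gatesS3))

gatesS9-isS2Form : IsS2Form (bilinearForm gatesS9)
gatesS9-isS2Form = from-yes (isS2Form? (bilinearForm gatesS9))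

tower : ∀ {r} → List (RankOne r) → (t : ℕ) → List (RankOne (t * 8 + r))
tower ps zero    = ps
tower ps (suc t) = glue gatesS9 (tower ps t)

tower-isS2Form : ∀ {r} (ps : List (RankOne r)) → IsS2Form (bilinearForm ps) →
                 ∀ t → IsS2Form (bilinearForm (tower ps t))
tower-isS2Form ps ps-S2 zero    = ps-S2
tower-isS2Form ps ps-S2 (suc t) =
  glue-isS2Form gatesS9 (tower ps t) gatesS9-isS2Form (tower-isS2Form ps ps-S2 t)

length-tower : ∀ (h : ℕ → ℕ) → (∀ x → h (8 + x) ≡ 4 + h x) →
               ∀ {r} (ps : List (RankOne r)) → length ps ≡ h r →
               ∀ t → length (tower ps t) ≡ h (t * 8 + r)
length-tower h h-step ps ps-length zero    = ps-length
length-tower h h-step ps ps-length (suc t) =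
  trans (length-glue gatesS9 (tower ps t))
        (trans (cong (4 +_) (length-tower h h-step ps ps-length t)) (sym (h-step (t * 8 + _))))

[t*8+r]%4≡r%4 : ∀ t r → (t * 8 + r) % 4 ≡ r % 4
[t*8+r]%4≡r%4 t r = begin
  (t * 8 + r) % 4      ≡⟨ cong (_% 4) (+-comm (t * 8) r) ⟩
  (r + t * 8) % 4      ≡⟨ cong (λ x → (r + x) % 4) (sym (*-assoc t 2 4)) ⟩
  (r + t * 2 * 4) % 4  ≡⟨ [m+kn]%n≡m%n r (t * 2) 4 ⟩
  r % 4                ∎

S2-circuits-unbounded : ∀ (h : ℕ → ℕ) → (∀ x → h (8 + x) ≡ 4 + h x) →
  ∀ {r} (ps : List (RankOne r)) → IsS2Form (bilinearForm ps) → length ps ≡ h r → ∀ N →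
  ∃[ n ] (N < n × n % 4 ≡ r % 4 × ∃[ C ] (Homogeneous {n} C × gates C ≡ h n × Computes C (S2 n)))
S2-circuits-unbounded h h-step {r} ps ps-S2 ps-length N =
  suc N * 8 + r ,
  <-≤-trans (n<1+n N) (≤-trans (m≤m*n (suc N) 8) (m≤m+n (suc N * 8) r)) ,
  [t*8+r]%4≡r%4 (suc N) r ,
  circuit (tower ps (suc N)) ,
  circuit-homogeneous (tower ps (suc N)) ,
  trans (gates-circuit (tower ps (suc N))) (length-tower h h-step ps ps-length (suc N)) ,
  circuit-computes-S2 (tower ps (suc N)) (tower-isS2Form ps ps-S2 (suc N))

mainTheorem3 : ((c : ℕ) → (c ≡ 0 ⊎ c ≡ 2 ⊎ c ≡ 3) → (N : ℕ) →
                   ∃[ n ] (N < n × n % 4 ≡ c ×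
                     ∃[ C ] (Homogeneous {n} C × gates C ≡ ⌈ n /2⌉ × Computes C (S2 n))))
                 × ((N : ℕ) →
                   ∃[ n ] (N < n × n % 4 ≡ 1 ×
                     ∃[ C ] (Homogeneous {n} C × gates C ≡ ⌊ n /2⌋ × Computes C (S2 n))))
mainTheorem3 = ceiling , S2-circuits-unbounded ⌊_/2⌋ (λ _ → refl) gatesS1 gatesS1-isS2Form refl
  where
  ceiling : (c : ℕ) → (c ≡ 0 ⊎ c ≡ 2 ⊎ c ≡ 3) → (N : ℕ) →
            ∃[ n ] (N < n × n % 4 ≡ c × ∃[ C ] (Homogeneous {n} C × gates C ≡ ⌈ n /2⌉ × Computes C (S2 n)))
  ceiling .0 (inj₁ refl)        = S2-circuits-unbounded ⌈_/2⌉ (λ _ → refl) gatesS0 gatesS0-isS2Form refl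
  ceiling .2 (inj₂ (inj₁ refl)) = S2-circuits-unbounded ⌈_/2⌉ (λ _ → refl) gatesS2 gatesS2-isS2Form refl
  ceiling .3 (inj₂ (inj₂ refl)) = S2-circuits-unbounded ⌈_/2⌉ (λ _ → refl) gatesS3 gatesS3-isS2Form refl
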